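{- Two permutations $u,v\in\mathfrak S_n$ are L-equivalent if and only if the nondecreasing rearrangements of their Lehmer codes are equal.
   Context: The Lehmer code of $w=w_1\cdots w_n$ is $\operatorname{Lc}(w)=(c_1,\ldots,c_n)$ with $c_i=\#\{j>i:w_j<w_i\}$. Two words $u,v$ are L-adjacent if there exist words $w_1,w_2,w_3,w_4$ and letters $a<b<c$ such that $u=w_1\,a\,w_2\,c\,w_3\,b\,w_4$ and $v=w_1\,b\,w_2\,a\,w_3\,c\,w_4$, where all letters of $w_2$ are greater than $b$, and all letters of $w_3$ and $w_4$ are either smaller than $b$ or greater than $c$. L-equivalence is the equivalence relation generated by L-adjacency: $u\sim v$ if there is a chain $u=u_1,u_2,\ldots,u_k=v$ with $u_i$ and $u_{i+1}$ L-adjacent (in either order) for all $i$. -}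

module Defs where

open import Data.Nat using (ℕ; zero; suc; _<_; _>_)
open import Data.Nat.Properties using (≤-decTotalOrder)
open import Data.List using (List; []; _∷_; _++_; length; map; upTo; filter)
open import Data.List.Relation.Unary.All using (All)
open import Data.List.Relation.Binary.Permutation.Propositional using (_↭_)
open import Data.Nat using (_<?_)
open import Data.Product using (Σ; _×_; _,_)
open import Data.Sum using (_⊎_)
open import Relation.Binary.PropositionalEquality using (_≡_)
open import Relation.Binary.Construct.Closure.Equivalence using (EqClosure)
import Data.List.Sort

Word : Set
Word = List ℕ

-- Permutations of S_n in one-line notation: words that are a rearrangement of 1,2,...,n.
IsPerm : ℕ → Word → Set
IsPerm n w = w ↭ map suc (upTo n)

lehmer : Word → List ℕ
lehmer [] = []
lehmer (x ∷ xs) = length (filter (λ y → y <? x) xs) ∷ lehmer xs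

open Data.List.Sort ≤-decTotalOrder using (sort) public

record LAdj (u v : Word) : Set where
  constructor ladj
  field
    w₁ w₂ w₃ w₄ : Word
    a b c : ℕ
    a<b : a < b
    b<c : b < c
    w₂-big : All (λ x → x > b) w₂
    w₃-ok : All (λ x → x < b ⊎ x > c) w₃
    w₄-ok : All (λ x → x < b ⊎ x > c) w₄
    u-eq : u ≡ w₁ ++ a ∷ w₂ ++ c ∷ w₃ ++ b ∷ w₄
    v-eq : v ≡ w₁ ++ b ∷ w₂ ++ a ∷ w₃ ++ c ∷ w₄

-- L-equivalence: equivalence relation generated by L-adjacency (chains through arbitrary words).
_∼L_ : Word → Word → Set
_∼L_ = EqClosure LAdj

-- An L-move permutes the letters of a word and exchanges the Lehmer code entries of the
-- letters a and c, so L-equivalent words have the same sorted code. Conversely, suppose a word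
-- with distinct letters has adjacent letters a c whose code entries form an ascent x < y.
-- The largest letter b right of c that is smaller than c exceeds a (the ascent puts some
-- letter right of c between a and c), and w₁ a c w₃ b w₄ is L-adjacent to w₁ b a w₃ c w₄,
-- whose code is the old one with x and y swapped. This lowers Σᵢ i·cᵢ, so every word is
-- L-equivalent to one with weakly decreasing code. Two such words with the same letters and
-- the same code multiset then have the same code, and a word is determined by its letters
-- and its code.
module Submission where

open import Defs
open import Data.Nat using (ℕ; suc; _+_; _<_; _>_; _≤_; _≥_; z≤n; s≤s)
open import Data.Nat.Properties
open import Data.Nat.ListAction using (sum)
open import Data.Nat.ListAction.Properties using (sum-↭)
open import Data.Nat.Induction using (<-wellFounded)
open import Data.List using (List; []; _∷_; _++_; length; filter)
open import Data.List.Properties using (length-++; filter-++; filter-accept; filter-reject; ∷-injective)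
open import Data.List.Relation.Unary.All as All using (All; []; _∷_)
open import Data.List.Relation.Unary.All.Properties using (¬All⇒Any¬; all-filter; ++⁻; ++⁺)
open import Data.List.Relation.Unary.AllPairs using (_∷_)
open import Data.List.Relation.Unary.Linked using (Linked; []; [-]; _∷_)
open import Data.List.Relation.Unary.Unique.Propositional using (Unique)
open import Data.List.Relation.Unary.Unique.Propositional.Properties using (map⁺; upTo⁺)
open import Data.List.Membership.Propositional using (_∈_; find)
open import Data.List.Membership.Propositional.Properties using (∈-filter⁺; ∈-filter⁻; ∈-∃++)
open import Data.List.Relation.Unary.Any using (there)
open import Data.List.Relation.Binary.Sublist.Propositional using (_⊆_; _∷ʳ_; ⊆-refl)
open import Data.List.Relation.Binary.Sublist.Propositional.Properties using (filter⁺; length-mono-≤)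
open import Data.List.Relation.Binary.Permutation.Propositional
  using (_↭_; ↭-refl; ↭-sym; ↭-trans; ↭-prep; ↭-swap; ↭-reflexive; ↭-isEquivalence; ↭⇒↭ₛ)
open import Data.List.Relation.Binary.Permutation.Propositional.Properties
  using (shift; ++⁺ˡ; drop-∷; filter-↭; ↭-length; ↭-empty-inv; ∈-resp-↭)
import Data.List.Relation.Binary.Permutation.Setoid.Properties as SetoidPermutation
open import Data.List.Relation.Binary.Pointwise using (Pointwise-≡⇒≡)
import Data.List.Relation.Unary.Sorted.TotalOrder.Properties as Sorted
import Relation.Binary.Construct.Flip.EqAndOrd as Flip
open import Data.List.Extrema.Nat using (max; ⊥≤max; xs≤max; max<v⁺; argmax-sel)
import Data.List.Sort
open Data.List.Sort ≤-decTotalOrder using (sort-↗; sort-↭)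
import Relation.Binary.Construct.Closure.Equivalence as EqClosure
open import Data.Product using (∃-syntax; _×_; _,_; proj₁; proj₂)
open import Data.Sum using (_⊎_; inj₁; inj₂; [_,_]′; map₂)
open import Data.Empty using (⊥-elim)
open import Function using (id; _∘_)
open import Function.Bundles using (_⇔_; mk⇔; Equivalence)
open import Induction.WellFounded using (Acc; acc)
open import Relation.Binary using (tri<; tri≈; tri>)
open import Relation.Binary.PropositionalEquality
open import Relation.Nullary using (¬_; yes; no; contradiction)
open import Relation.Nullary.Decidable using (_⊎-dec_)

Unique-resp-↭ : ∀ {xs ys : Word} → Unique xs → xs ↭ ys → Unique ys
Unique-resp-↭ u p = SetoidPermutation.Unique-resp-↭ (setoid ℕ) (↭⇒↭ₛ p) u

Unique-++⁻ʳ : ∀ (xs : Word) {ys} → Unique (xs ++ ys) → Unique ys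
Unique-++⁻ʳ []       u       = u
Unique-++⁻ʳ (_ ∷ xs) (_ ∷ u) = Unique-++⁻ʳ xs u

IsPerm⇒Unique : ∀ {n w} → IsPerm n w → Unique w
IsPerm⇒Unique {n} p = Unique-resp-↭ (map⁺ suc-injective (upTo⁺ n)) (↭-sym p)

↭-swap-ends : ∀ {A : Set} (xs : List A) x ys y zs → xs ++ x ∷ ys ++ y ∷ zs ↭ xs ++ y ∷ ys ++ x ∷ zs
↭-swap-ends xs x ys y zs = ++⁺ˡ xs
  (↭-trans (↭-prep x (shift y ys zs))
  (↭-trans (↭-swap x y ↭-refl)
           (↭-prep y (↭-sym (shift x ys zs)))))

-- lehmer (x ∷ w) is definitionally below x w ∷ lehmer w.
below : ℕ → Word → ℕ
below x w = length (filter (_<? x) w)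

below-++ : ∀ x xs ys → below x (xs ++ ys) ≡ below x xs + below x ys
below-++ x xs ys = trans (cong length (filter-++ (_<? x) xs ys)) (length-++ (filter (_<? x) xs))

below-↭ : ∀ x {xs ys} → xs ↭ ys → below x xs ≡ below x ys
below-↭ x p = ↭-length (filter-↭ (_<? x) p)

below-mono : ∀ {x y xs ys} → x ≤ y → xs ⊆ ys → below x xs ≤ below y ys
below-mono x≤y xs⊆ys =
  length-mono-≤ (filter⁺ (_<? _) (_<? _) (λ { refl z<x → <-≤-trans z<x x≤y }) xs⊆ys)

below-insert-< : ∀ {x y} xs ys → y < x → below x (xs ++ y ∷ ys) ≡ suc (below x (xs ++ ys))
below-insert-< {x} {y} xs ys y<x = begin
  below x (xs ++ y ∷ ys)  ≡⟨ below-↭ x (shift y xs ys) ⟩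
  below x (y ∷ xs ++ ys)  ≡⟨ cong length (filter-accept (_<? x) y<x) ⟩
  suc (below x (xs ++ ys)) ∎
  where open ≡-Reasoning

below-insert-≮ : ∀ {x y} xs ys → ¬ y < x → below x (xs ++ y ∷ ys) ≡ below x (xs ++ ys)
below-insert-≮ {x} {y} xs ys y≮x = begin
  below x (xs ++ y ∷ ys)  ≡⟨ below-↭ x (shift y xs ys) ⟩
  below x (y ∷ xs ++ ys)  ≡⟨ cong length (filter-reject (_<? x) y≮x) ⟩
  below x (xs ++ ys)      ∎
  where open ≡-Reasoning

below-++-none : ∀ {x} xs ys → All (x ≤_) xs → below x (xs ++ ys) ≡ below x ys
below-++-none []       ys []           = refl
below-++-none (_ ∷ xs) ys (x≤z ∷ x≤xs) =
  trans (below-insert-≮ [] (xs ++ ys) (≤⇒≯ x≤z)) (below-++-none xs ys x≤xs)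

below-gap : ∀ {x y} w → All (λ z → z < x ⊎ y ≤ z) w → below y w ≤ below x w
below-gap []      []       = z≤n
below-gap {x} {y} (z ∷ w) (g ∷ gs) with z <? y | z <? x
... | yes z<y | yes z<x
  rewrite below-insert-< [] w z<y | below-insert-< [] w z<x = s≤s (below-gap w gs)
... | no z≮y  | yes z<x
  rewrite below-insert-≮ [] w z≮y | below-insert-< [] w z<x = m≤n⇒m≤1+n (below-gap w gs)
... | no z≮y  | no z≮x
  rewrite below-insert-≮ [] w z≮y | below-insert-≮ [] w z≮x = below-gap w gs
... | yes z<y | no z≮x = ⊥-elim ([ z≮x , <⇒≱ z<y ]′ g)

Outside : ℕ → ℕ → ℕ → Set
Outside b c x = x < b ⊎ x > c

below-threshold : ∀ {b c w} → b ≤ c → All (Outside b c) w → below b w ≡ below c w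
below-threshold {w = w} b≤c out =
  ≤-antisym (below-mono {xs = w} b≤c ⊆-refl) (below-gap w (All.map (map₂ <⇒≤) out))

lehmerPrefix : Word → Word → List ℕ
lehmerPrefix []      s = []
lehmerPrefix (x ∷ w) s = below x (w ++ s) ∷ lehmerPrefix w s

lehmer-++ : ∀ w s → lehmer (w ++ s) ≡ lehmerPrefix w s ++ lehmer s
lehmer-++ []      s = refl
lehmer-++ (x ∷ w) s = cong (below x (w ++ s) ∷_) (lehmer-++ w s)

lehmerPrefix-cong : ∀ {s s'} w → All (λ x → below x s ≡ below x s') w →
                    lehmerPrefix w s ≡ lehmerPrefix w s'
lehmerPrefix-cong          []      []       = refl
lehmerPrefix-cong {s} {s'} (x ∷ w) (e ∷ es) = cong₂ _∷_ same (lehmerPrefix-cong w es)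
  where
  same : below x (w ++ s) ≡ below x (w ++ s')
  same = trans (below-++ x w s) (trans (cong (below x w +_) e) (sym (below-++ x w s')))

lehmerPrefix-↭ : ∀ {s s'} w → s ↭ s' → lehmerPrefix w s ≡ lehmerPrefix w s'
lehmerPrefix-↭ []      p = refl
lehmerPrefix-↭ (x ∷ w) p = cong₂ _∷_ (below-↭ x (++⁺ˡ w p)) (lehmerPrefix-↭ w p)

lehmer-raise : ∀ {b c} w₃ {w₄} → b ≤ c → All (Outside b c) w₃ → All (Outside b c) w₄ →
               lehmer (w₃ ++ b ∷ w₄) ≡ lehmer (w₃ ++ c ∷ w₄)
lehmer-raise {b} {c} w₃ {w₄} b≤c w₃-out w₄-out = begin
  lehmer (w₃ ++ b ∷ w₄)                               ≡⟨ lehmer-++ w₃ (b ∷ w₄) ⟩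
  lehmerPrefix w₃ (b ∷ w₄) ++ below b w₄ ∷ lehmer w₄  ≡⟨ cong₂ (λ p k → p ++ k ∷ lehmer w₄)
                                                           (lehmerPrefix-cong w₃ (All.map same-rank w₃-out))
                                                           (below-threshold b≤c w₄-out) ⟩
  lehmerPrefix w₃ (c ∷ w₄) ++ below c w₄ ∷ lehmer w₄  ≡⟨ lehmer-++ w₃ (c ∷ w₄) ⟨
  lehmer (w₃ ++ c ∷ w₄)                               ∎
  where
  open ≡-Reasoning
  same-rank : ∀ {x} → Outside b c x → below x (b ∷ w₄) ≡ below x (c ∷ w₄)
  same-rank (inj₁ x<b) = trans (below-insert-≮ [] w₄ (<⇒≯ x<b))
                               (sym (below-insert-≮ [] w₄ (<⇒≯ (<-≤-trans x<b b≤c))))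
  same-rank (inj₂ c<x) = trans (below-insert-< [] w₄ (≤-<-trans b≤c c<x))
                               (sym (below-insert-< [] w₄ c<x))

module LAdjCode (w₁ w₂ w₃ w₄ : Word) (a b c : ℕ) where

  tail↭ : a ∷ w₂ ++ c ∷ w₃ ++ b ∷ w₄ ↭ b ∷ w₂ ++ a ∷ w₃ ++ c ∷ w₄
  tail↭ = ↭-trans (↭-swap-ends (a ∷ w₂) c w₃ b w₄) (↭-swap-ends [] a w₂ b (w₃ ++ c ∷ w₄))

  P Q R : List ℕ
  P = lehmerPrefix w₁ (a ∷ w₂ ++ c ∷ w₃ ++ b ∷ w₄)
  Q = lehmerPrefix w₂ (c ∷ w₃ ++ b ∷ w₄)
  R = lehmer (w₃ ++ b ∷ w₄)

  X Y : ℕ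
  X = below a (w₂ ++ c ∷ w₃ ++ b ∷ w₄)
  Y = below c (w₃ ++ b ∷ w₄)

  lehmer-u : lehmer (w₁ ++ a ∷ w₂ ++ c ∷ w₃ ++ b ∷ w₄) ≡ P ++ X ∷ Q ++ Y ∷ R
  lehmer-u = trans (lehmer-++ w₁ _) (cong (λ t → P ++ X ∷ t) (lehmer-++ w₂ _))

  module _ (a<b : a < b) (b<c : b < c) (w₂-big : All (_> b) w₂)
           (w₃-out : All (Outside b c) w₃) (w₄-out : All (Outside b c) w₄) where
    open ≡-Reasoning

    code-b : below b (w₂ ++ a ∷ w₃ ++ c ∷ w₄) ≡ Y
    code-b = begin
      below b (w₂ ++ a ∷ w₃ ++ c ∷ w₄)  ≡⟨ below-++-none w₂ _ (All.map <⇒≤ w₂-big) ⟩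
      below b (a ∷ w₃ ++ c ∷ w₄)        ≡⟨ below-insert-< [] _ a<b ⟩
      suc (below b (w₃ ++ c ∷ w₄))      ≡⟨ cong suc (below-insert-≮ w₃ w₄ (<⇒≯ b<c)) ⟩
      suc (below b (w₃ ++ w₄))          ≡⟨ cong suc (below-threshold (<⇒≤ b<c) (++⁺ w₃-out w₄-out)) ⟩
      suc (below c (w₃ ++ w₄))          ≡⟨ below-insert-< w₃ w₄ b<c ⟨
      below c (w₃ ++ b ∷ w₄)            ∎

    code-w₂ : lehmerPrefix w₂ (a ∷ w₃ ++ c ∷ w₄) ≡ Q
    code-w₂ = lehmerPrefix-cong w₂ (All.map same-rank w₂-big)
      where
      same-rank : ∀ {x} → b < x → below x (a ∷ w₃ ++ c ∷ w₄) ≡ below x (c ∷ w₃ ++ b ∷ w₄)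
      same-rank {x} b<x = begin
        below x (a ∷ w₃ ++ c ∷ w₄)    ≡⟨ below-insert-< [] _ (<-trans a<b b<x) ⟩
        suc (below x (w₃ ++ c ∷ w₄))  ≡⟨ below-insert-< [] _ b<x ⟨
        below x (b ∷ w₃ ++ c ∷ w₄)    ≡⟨ below-↭ x (↭-swap-ends [] b w₃ c w₄) ⟩
        below x (c ∷ w₃ ++ b ∷ w₄)    ∎

    code-a : below a (w₃ ++ c ∷ w₄) ≡ X
    code-a = begin
      below a (w₃ ++ c ∷ w₄)            ≡⟨ below-insert-≮ w₃ w₄ (<⇒≯ (<-trans a<b b<c)) ⟩
      below a (w₃ ++ w₄)                ≡⟨ below-insert-≮ w₃ w₄ (<⇒≯ a<b) ⟨
      below a (w₃ ++ b ∷ w₄)            ≡⟨ below-insert-≮ [] _ (<⇒≯ (<-trans a<b b<c)) ⟨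
      below a (c ∷ w₃ ++ b ∷ w₄)        ≡⟨ below-++-none w₂ _ (All.map (<⇒≤ ∘ <-trans a<b) w₂-big) ⟨
      below a (w₂ ++ c ∷ w₃ ++ b ∷ w₄)  ∎

    lehmer-v : lehmer (w₁ ++ b ∷ w₂ ++ a ∷ w₃ ++ c ∷ w₄) ≡ P ++ Y ∷ Q ++ X ∷ R
    lehmer-v = begin
      lehmer (w₁ ++ b ∷ w₂ ++ a ∷ w₃ ++ c ∷ w₄)
        ≡⟨ lehmer-++ w₁ _ ⟩
      lehmerPrefix w₁ (b ∷ w₂ ++ a ∷ w₃ ++ c ∷ w₄) ++ lehmer (b ∷ w₂ ++ a ∷ w₃ ++ c ∷ w₄)
        ≡⟨ cong₂ _++_ (lehmerPrefix-↭ w₁ (↭-sym tail↭)) (cong₂ _∷_ code-b (lehmer-++ w₂ _)) ⟩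
      P ++ Y ∷ lehmerPrefix w₂ (a ∷ w₃ ++ c ∷ w₄) ++ below a (w₃ ++ c ∷ w₄) ∷ lehmer (w₃ ++ c ∷ w₄)
        ≡⟨ cong (λ t → P ++ Y ∷ t) (cong₂ _++_ code-w₂ (cong₂ _∷_ code-a
             (sym (lehmer-raise w₃ (<⇒≤ b<c) w₃-out w₄-out)))) ⟩
      P ++ Y ∷ Q ++ X ∷ R
        ∎

LAdj⇒↭ : ∀ {u v} → LAdj u v → u ↭ v
LAdj⇒↭ (ladj w₁ w₂ w₃ w₄ a b c _ _ _ _ _ refl refl) = ++⁺ˡ w₁ (LAdjCode.tail↭ w₁ w₂ w₃ w₄ a b c)

LAdj⇒lehmer-↭ : ∀ {u v} → LAdj u v → lehmer u ↭ lehmer v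
LAdj⇒lehmer-↭ (ladj w₁ w₂ w₃ w₄ a b c a<b b<c w₂-big w₃-out w₄-out refl refl) =
  subst₂ _↭_ (sym lehmer-u) (sym (lehmer-v a<b b<c w₂-big w₃-out w₄-out)) (↭-swap-ends P X Q Y R)
  where open LAdjCode w₁ w₂ w₃ w₄ a b c

∼L⇒↭ : ∀ {u v} → u ∼L v → u ↭ v
∼L⇒↭ = EqClosure.gfold ↭-isEquivalence id LAdj⇒↭

∼L⇒lehmer-↭ : ∀ {u v} → u ∼L v → lehmer u ↭ lehmer v
∼L⇒lehmer-↭ = EqClosure.gfold ↭-isEquivalence lehmer LAdj⇒lehmer-↭

-- weight xs = Σᵢ i · xsᵢ, positions counted from 0.
weight : List ℕ → ℕ
weight []       = 0
weight (x ∷ xs) = sum xs + weight xs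

weight-swap-< : ∀ xs {x y} zs → x < y → weight (xs ++ y ∷ x ∷ zs) < weight (xs ++ x ∷ y ∷ zs)
weight-swap-< []       zs x<y = +-monoˡ-< (sum zs + weight zs) (+-monoˡ-< (sum zs) x<y)
weight-swap-< (_ ∷ xs) {x} {y} zs x<y =
  +-mono-≤-< (≤-reflexive (sum-↭ (++⁺ˡ xs (↭-swap y x ↭-refl)))) (weight-swap-< xs zs x<y)

data DecreasingOrAscent (u : Word) : Set where
  decreasing : Linked _≥_ (lehmer u) → DecreasingOrAscent u
  ascent     : ∀ w a c r → u ≡ w ++ a ∷ c ∷ r → below a (c ∷ r) < below c r → DecreasingOrAscent u

decreasingOrAscent : ∀ u → DecreasingOrAscent u
decreasingOrAscent []           = decreasing []
decreasingOrAscent (x ∷ [])     = decreasing [-]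
decreasingOrAscent (x ∷ y ∷ ys) with decreasingOrAscent (y ∷ ys)
... | ascent w a c r split asc = ascent (x ∷ w) a c r (cong (x ∷_) split) asc
... | decreasing dec with below y ys ≤? below x (y ∷ ys)
...   | yes ≥ = decreasing (≥ ∷ dec)
...   | no ≱  = ascent [] x y ys refl (≰⇒> ≱)

∃-between : ∀ {a c} r → below a r < below c r → ∃[ z ] z ∈ r × a ≤ z × z < c
∃-between {a} {c} r lt with find (¬All⇒Any¬ (λ z → z <? a ⊎-dec c ≤? z) r (<⇒≱ lt ∘ below-gap r))
... | z , z∈r , z∉gap = z , z∈r , ≮⇒≥ (z∉gap ∘ inj₁) , ≰⇒> (z∉gap ∘ inj₂)

largestBelow : ℕ → ℕ → Word → ℕ
largestBelow c z r = max z (filter (_<? c) r)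

largestBelow-∈ : ∀ c {z r} → z ∈ r → largestBelow c z r ∈ r
largestBelow-∈ c {z} {r} z∈r with argmax-sel id z (filter (_<? c) r)
... | inj₁ max≡z   = subst (_∈ r) (sym max≡z) z∈r
... | inj₂ max∈lower = proj₁ (∈-filter⁻ (_<? c) max∈lower)

largestBelow-≥ : ∀ c z r → z ≤ largestBelow c z r
largestBelow-≥ c z r = ⊥≤max z (filter (_<? c) r)

largestBelow-< : ∀ {c z} r → z < c → largestBelow c z r < c
largestBelow-< {c} r z<c = max<v⁺ z<c (all-filter (_<? c) r)

largestBelow-maximal : ∀ {c y} z {r} → y ∈ r → y < c → y ≤ largestBelow c z r
largestBelow-maximal {c} z {r} y∈r y<c =
  All.lookup (xs≤max z (filter (_<? c) r)) (∈-filter⁺ (_<? c) y∈r y<c)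

record Pivot (a c : ℕ) (r : Word) : Set where
  constructor pivot
  field
    b      : ℕ
    w₃ w₄  : Word
    split  : r ≡ w₃ ++ b ∷ w₄
    a<b    : a < b
    b<c    : b < c
    w₃-out : All (Outside b c) w₃
    w₄-out : All (Outside b c) w₄

∃-pivot : ∀ {a c r} → All (a ≢_) r → All (c ≢_) r → Unique r → below a r < below c r → Pivot a c r
∃-pivot {a} {c} {r} a∉r c∉r r-unique lt with ∃-between r lt
... | z , z∈r , a≤z , z<c with ∈-∃++ (largestBelow-∈ c z∈r)
...   | w₃ , w₄ , split =
  pivot b w₃ w₄ split a<b (largestBelow-< r z<c) (proj₁ (++⁻ w₃ rest-out)) (proj₂ (++⁻ w₃ rest-out))
  where
  b : ℕ
  b = largestBelow c z r
  a<b : a < b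
  a<b = ≤∧≢⇒< (≤-trans a≤z (largestBelow-≥ c z r)) (All.lookup a∉r (largestBelow-∈ c z∈r))
  r↭ : r ↭ b ∷ w₃ ++ w₄
  r↭ = ↭-trans (↭-reflexive split) (shift b w₃ w₄)
  b∉rest : All (b ≢_) (w₃ ++ w₄)
  b∉rest with b∉ ∷ _ ← Unique-resp-↭ r-unique r↭ = b∉
  outside : ∀ {y} → y ∈ r → y ≢ b → Outside b c y
  outside {y} y∈r y≢b with y <? b
  ... | yes y<b = inj₁ y<b
  ... | no y≮b  = inj₂ (≤∧≢⇒< c≤y (All.lookup c∉r y∈r))
    where
    c≤y : c ≤ y
    c≤y = ≮⇒≥ λ y<c → y≢b (≤-antisym (largestBelow-maximal z y∈r y<c) (≮⇒≥ y≮b))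
  rest-out : All (Outside b c) (w₃ ++ w₄)
  rest-out = All.tabulate λ y∈ →
    outside (∈-resp-↭ (↭-sym r↭) (there y∈)) (λ y≡b → All.lookup b∉rest y∈ (sym y≡b))

ascent⇒LAdj : ∀ w {a c r} → Unique (a ∷ c ∷ r) → below a (c ∷ r) < below c r →
  ∃[ v ] LAdj (w ++ a ∷ c ∷ r) v × weight (lehmer v) < weight (lehmer (w ++ a ∷ c ∷ r))
ascent⇒LAdj w {a} {c} {r} ((_ ∷ a∉r) ∷ c∉r ∷ r-unique) asc
  with ∃-pivot a∉r c∉r r-unique (≤-<-trans (below-mono {a} {xs = r} ≤-refl (c ∷ʳ ⊆-refl)) asc)
... | pivot b w₃ w₄ refl a<b b<c w₃-out w₄-out =
  w ++ b ∷ a ∷ w₃ ++ c ∷ w₄ ,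
  ladj w [] w₃ w₄ a b c a<b b<c [] w₃-out w₄-out refl refl ,
  subst₂ (λ p q → weight p < weight q) (sym (lehmer-v a<b b<c [] w₃-out w₄-out)) (sym lehmer-u)
         (weight-swap-< P R asc)
  where open LAdjCode w [] w₃ w₄ a b c

∼L-decreasing : ∀ u → Unique u → ∃[ v ] u ∼L v × Linked _≥_ (lehmer v)
∼L-decreasing u = go u (<-wellFounded (weight (lehmer u)))
  where
  go : ∀ u → Acc _<_ (weight (lehmer u)) → Unique u → ∃[ v ] u ∼L v × Linked _≥_ (lehmer v)
  go u (acc lighter) u-unique with decreasingOrAscent u
  ... | decreasing dec = u , EqClosure.reflexive LAdj , dec
  ... | ascent w a c r refl asc with ascent⇒LAdj w (Unique-++⁻ʳ w u-unique) asc
  ...   | v , u-v , v-lighter with go v (lighter v-lighter) (Unique-resp-↭ u-unique (LAdj⇒↭ u-v))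
  ...     | v' , v∼v' , dec = v' , EqClosure.transitive LAdj (EqClosure.return u-v) v∼v' , dec

below-head-< : ∀ {x y xs ys} → x < y → x ∷ xs ↭ y ∷ ys → below x xs < below y ys
below-head-< {x} {y} {xs} {ys} x<y p = begin-strict
  below x xs        ≤⟨ below-mono {xs = xs} (<⇒≤ x<y) ⊆-refl ⟩
  below y xs        <⟨ n<1+n _ ⟩
  suc (below y xs)  ≡⟨ below-insert-< [] xs x<y ⟨
  below y (x ∷ xs)  ≡⟨ below-↭ y p ⟩
  below y (y ∷ ys)  ≡⟨ below-insert-≮ [] ys (<-irrefl refl) ⟩
  below y ys        ∎
  where open ≤-Reasoning

lehmer-injective : ∀ {xs ys} → xs ↭ ys → lehmer xs ≡ lehmer ys → xs ≡ ys
lehmer-injective {[]}     {[]}     _ _ = refl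
lehmer-injective {[]}     {_ ∷ _}  p _ = contradiction (↭-empty-inv (↭-sym p)) λ ()
lehmer-injective {_ ∷ _}  {[]}     p _ = contradiction (↭-empty-inv p) λ ()
lehmer-injective {x ∷ xs} {y ∷ ys} p e with <-cmp x y | ∷-injective e
... | tri< x<y _ _  | same , _    = contradiction same (<⇒≢ (below-head-< x<y p))
... | tri≈ _ refl _ | _    , rest = cong (x ∷_) (lehmer-injective (drop-∷ p) rest)
... | tri> _ _ y<x  | same , _    = contradiction (sym same) (<⇒≢ (below-head-< y<x (↭-sym p)))

increasing-↭⇒≡ : ∀ {xs ys} → Linked _≤_ xs → Linked _≤_ ys → xs ↭ ys → xs ≡ ys
increasing-↭⇒≡ xs↗ ys↗ p = Pointwise-≡⇒≡ (Sorted.↗↭↗⇒≋ ≤-totalOrder xs↗ ys↗ (↭⇒↭ₛ p))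

decreasing-↭⇒≡ : ∀ {xs ys} → Linked _≥_ xs → Linked _≥_ ys → xs ↭ ys → xs ≡ ys
decreasing-↭⇒≡ xs↘ ys↘ p =
  Pointwise-≡⇒≡ (Sorted.↗↭↗⇒≋ (Flip.totalOrder ≤-totalOrder) xs↘ ys↘ (↭⇒↭ₛ p))

sort-≡⇔↭ : ∀ {xs ys} → (sort xs ≡ sort ys) ⇔ (xs ↭ ys)
sort-≡⇔↭ {xs} {ys} = mk⇔
  (λ e → ↭-trans (↭-sym (sort-↭ xs)) (subst (_↭ ys) (sym e) (sort-↭ ys)))
  (λ p → increasing-↭⇒≡ (sort-↗ xs) (sort-↗ ys) (↭-trans (sort-↭ xs) (↭-trans p (↭-sym (sort-↭ ys)))))

∼L-complete : ∀ {u v} → Unique u → u ↭ v → lehmer u ↭ lehmer v → u ∼L v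
∼L-complete {u} {v} u-unique u↭v codes↭
  with ∼L-decreasing u u-unique | ∼L-decreasing v (Unique-resp-↭ u-unique u↭v)
... | u' , u∼u' , u'↘ | v' , v∼v' , v'↘ =
  EqClosure.transitive LAdj u∼u' (subst (_∼L v) (sym u'≡v') (EqClosure.symmetric LAdj v∼v'))
  where
  u'≡v' : u' ≡ v'
  u'≡v' = lehmer-injective
    (↭-trans (↭-sym (∼L⇒↭ u∼u')) (↭-trans u↭v (∼L⇒↭ v∼v')))
    (decreasing-↭⇒≡ u'↘ v'↘
      (↭-trans (↭-sym (∼L⇒lehmer-↭ u∼u')) (↭-trans codes↭ (∼L⇒lehmer-↭ v∼v'))))

mainTheorem18 : (n : ℕ) (u v : Word) → IsPerm n u → IsPerm n v →
    (u ∼L v) ⇔ (sort (lehmer u) ≡ sort (lehmer v))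
mainTheorem18 n u v pu pv = mk⇔
  (λ u∼v → Equivalence.from sort-≡⇔↭ (∼L⇒lehmer-↭ u∼v))
  (λ same-sort → ∼L-complete (IsPerm⇒Unique pu) (↭-trans pu (↭-sym pv)) (Equivalence.to sort-≡⇔↭ same-sort))
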